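{- Let $\boldsymbol{\alpha}$, $\boldsymbol{\beta}$, $\boldsymbol{\beta}'$ be sets of $\mathcal{T}$-atoms, where $\boldsymbol{\beta}$ and $\boldsymbol{\beta}'$ consist of extra atoms not in $\boldsymbol{\alpha}$, with Boolean abstractions $\mathbf{A}$, $\mathbf{B}$, $\mathbf{B}'$. Let $\varphi[\boldsymbol{\alpha}]$ and $\varphi'[\boldsymbol{\alpha}]$ be $\mathcal{T}$-formulas. Let $\mathrm{TLEMMAS}_{\boldsymbol{\alpha},\boldsymbol{\beta}}(\varphi)$ be a set of $\mathcal{T}$-lemmas on $\boldsymbol{\alpha}\cup\boldsymbol{\beta}$ which rules out $\mathrm{TTA}^{\neg\mathcal{T}}_{\boldsymbol{\alpha}}(\varphi)$, and $\mathrm{TLEMMAS}_{\boldsymbol{\alpha},\boldsymbol{\beta}'}(\varphi')$ a set of $\mathcal{T}$-lemmas on $\boldsymbol{\alpha}\cup\boldsymbol{\beta}'$ which rules out $\mathrm{TTA}^{\neg\mathcal{T}}_{\boldsymbol{\alpha}}(\varphi')$. Then $\varphi\equiv_{\mathcal{T}}\varphi'$ if and only if $$\varphi^p\wedge\exists\mathbf{B}.\!\!\bigwedge_{C_l\in\mathrm{TLEMMAS}_{\boldsymbol{\alpha},\boldsymbol{\beta}}(\varphi)}\!\!C_l^p\ \ \equiv\ \ \varphi'^p\wedge\exists\mathbf{B}'.\!\!\bigwedge_{C'_l\in\mathrm{TLEMMAS}_{\boldsymbol{\alpha},\boldsymbol{\beta}'}(\varphi')}\!\!C_l'^p,$$ where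 $\exists$ denotes Boolean existential quantification and $\equiv$ propositional equivalence.
   Context: All formulas are quantifier-free $\mathcal{T}$-formulas (Boolean combinations of ground $\mathcal{T}$-atoms, $\mathcal{T}$ a first-order theory). $\mathcal{T}2\mathcal{B}$ is the Boolean abstraction (bijection mapping Boolean atoms to themselves and other $\mathcal{T}$-atoms to fresh Boolean variables, homomorphic over connectives); $\psi^p:=\mathcal{T}2\mathcal{B}(\psi)$. $\varphi[\boldsymbol{\alpha}]$ means $\varphi$ regarded over a set $\boldsymbol{\alpha}$ containing all its atoms. $\psi\equiv_{\mathcal{T}}\psi'$ means equivalence modulo $\mathcal{T}$; $\equiv_{\mathcal{B}}$ means propositional equivalence of Boolean abstractions. Truth assignments are conjunctions of literals; total on $\boldsymbol{\alpha}$ means one literal per atom of $\boldsymbol{\alpha}$; $\rho\models_p\psi$ means $\rho^p\models\psi^p$. $\mathrm{TTA}^{\neg\mathcal{T}}_{\boldsymbol{\alpha}}(\varphi)$ is the set of $\mathcal{T}$-inconsistent total truth assignments on $\boldsymbol{\alpha}$ propositionally satisfying $\varphi$. A $\mathcal{T}$-lemma is a $\mathcal{T}$-valid clause. A set $\{C_1,\dots,C_K\}$ of $\mathcal{T}$-lemmas on $\boldsymbol{\alpha}\cup\boldsymbol{\beta}$ rules out a set $\{\rho_1,\dots,\rho_M\}$ of $\mathcal{T}$-inconsistent total truth assignments on $\boldsymbol{\alpha}$ iff $\bigvee_{j}\rho_j\wedge\bigwedge_{l}C_l\equiv_{\mathcal{B}}\bot$. -}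

module Defs where

open import Data.Bool using (Bool; true; false; not; _∧_; _∨_; if_then_else_)
open import Data.List using (List; []; _∷_; _++_)
open import Data.Bool.ListAction using (all; any)
open import Data.List.Membership.Propositional using (_∈_)
open import Data.Product using (_×_; _,_; ∃; proj₁)
open import Relation.Binary.PropositionalEquality using (_≡_)
open import Relation.Binary.Definitions using (DecidableEquality)
open import Relation.Nullary using (¬_; yes; no)
open import Data.List.Relation.Unary.All using (All)

-- An abstract first-order theory T, seen through its ground atoms:
-- every model M of T assigns a truth value to every ground T-atom.
-- (Boolean atoms are just atoms whose value is unconstrained.)
record Theory (Atom : Set) : Set₁ where
  field
    Model : Set
    ⟦_⟧   : Model → Atom → Bool

open Theory public

-- The Boolean abstraction T2B is a bijection on atoms, so we identify
-- each atom with its Boolean variable: ψ^p is ψ read propositionally.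
data Formula (Atom : Set) : Set where
  atom       : Atom → Formula Atom
  ⊤f ⊥f      : Formula Atom
  ¬f_        : Formula Atom → Formula Atom
  _∧f_ _∨f_ _⇒f_ _⇔f_ : Formula Atom → Formula Atom → Formula Atom

Val : Set → Set
Val Atom = Atom → Bool

module _ {Atom : Set} where

  _⇔b_ : Bool → Bool → Bool
  true  ⇔b b = b
  false ⇔b b = not b

  evalF : Val Atom → Formula Atom → Bool
  evalF ν (atom a) = ν a
  evalF ν ⊤f = true
  evalF ν ⊥f = false
  evalF ν (¬f ψ) = not (evalF ν ψ)
  evalF ν (ψ ∧f χ) = evalF ν ψ ∧ evalF ν χ
  evalF ν (ψ ∨f χ) = evalF ν ψ ∨ evalF ν χ
  evalF ν (ψ ⇒f χ) = not (evalF ν ψ) ∨ evalF ν χ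
  evalF ν (ψ ⇔f χ) = evalF ν ψ ⇔b evalF ν χ

  atoms : Formula Atom → List Atom
  atoms (atom a) = a ∷ []
  atoms ⊤f = []
  atoms ⊥f = []
  atoms (¬f ψ) = atoms ψ
  atoms (ψ ∧f χ) = atoms ψ ++ atoms χ
  atoms (ψ ∨f χ) = atoms ψ ++ atoms χ
  atoms (ψ ⇒f χ) = atoms ψ ++ atoms χ
  atoms (ψ ⇔f χ) = atoms ψ ++ atoms χ

  FormulaOn : List Atom → Formula Atom → Set
  FormulaOn α φ = All (_∈ α) (atoms φ)

Literal : Set → Set
Literal Atom = Atom × Bool

Clause : Set → Set
Clause Atom = List (Literal Atom)

module _ {Atom : Set} where

  evalLit : Val Atom → Literal Atom → Bool
  evalLit ν (a , b) = if b then ν a else not (ν a)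

  evalClause : Val Atom → Clause Atom → Bool
  evalClause ν C = any (evalLit ν) C

  allClauses : List (Clause Atom) → Val Atom → Bool
  allClauses Cs ν = all (evalClause ν) Cs

  TLemma : Theory Atom → Clause Atom → Set
  TLemma T C = ∀ M → evalClause (⟦ T ⟧ M) C ≡ true

  ClauseOn : List Atom → Clause Atom → Set
  ClauseOn γ C = All (λ l → proj₁ l ∈ γ) C

  AgreeOn : List Atom → Val Atom → Val Atom → Set
  AgreeOn α ρ μ = ∀ a → a ∈ α → ρ a ≡ μ a

  -- A total truth assignment on α is represented by a valuation ρ,
  -- of which only the values on α matter.
  -- ρ is T-consistent iff some model of T realises it.
  TConsistentOn : Theory Atom → List Atom → Val Atom → Set
  TConsistentOn T α ρ = ∃ λ M → AgreeOn α (⟦ T ⟧ M) ρ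

  TTAneg : Theory Atom → List Atom → Formula Atom → Val Atom → Set
  TTAneg T α φ ρ = (¬ TConsistentOn T α ρ) × (evalF ρ φ ≡ true)

  -- {C_l} rules out the set S of total truth assignments on α:
  -- ⋁_j ρ_j ∧ ⋀_l C_l is propositionally unsatisfiable.
  RulesOut : List Atom → List (Clause Atom) → (Val Atom → Set) → Set
  RulesOut α Cs S =
    ∀ μ → ¬ ((∃ λ ρ → S ρ × AgreeOn α ρ μ) × allClauses Cs μ ≡ true)

  TEquiv : Theory Atom → Formula Atom → Formula Atom → Set
  TEquiv T φ φ' = ∀ M → evalF (⟦ T ⟧ M) φ ≡ evalF (⟦ T ⟧ M) φ'

  PropEquiv : (Val Atom → Bool) → (Val Atom → Bool) → Set
  PropEquiv f g = ∀ μ → f μ ≡ g μ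

module _ {Atom : Set} (_≟_ : DecidableEquality Atom) where

  update : Val Atom → Atom → Bool → Val Atom
  update μ b v a with a ≟ b
  ... | yes _ = v
  ... | no  _ = μ a

  existsB : List Atom → (Val Atom → Bool) → Val Atom → Bool
  existsB [] F μ = F μ
  existsB (b ∷ bs) F μ = existsB bs F (update μ b true) ∨ existsB bs F (update μ b false)

  side : Formula Atom → List Atom → List (Clause Atom) → Val Atom → Bool
  side φ β Cs μ = evalF μ φ ∧ existsB β (allClauses Cs) μ

-- Every lemma in the lists is T-valid, so a T-consistent assignment μ on α extends,
-- by copying a model realising it onto β, to a valuation satisfying all the lemmas:
-- on T-consistent assignments each side of the equivalence is just φ^p (resp. φ'^p).
-- Conversely, if φ^p ∧ ∃B.⋀ C_l^p holds at μ, the witness for B agrees with μ on α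
-- (β is disjoint from α), so μ cannot be T-inconsistent, as the lemmas rule out every
-- T-inconsistent assignment satisfying φ. Hence both sides can only be true on
-- T-consistent assignments, where they are φ^p and φ'^p, and these agree iff φ ≡_T φ'.
module Submission where

open import Defs
open import Data.Bool using (Bool; true; false; not; _∧_; _∨_; if_then_else_)
open import Data.Bool.ListAction using (or)
import Data.Bool as Bool
open import Data.Bool.Properties
  using (∨-zeroʳ; ∧-identityʳ; ∧-conicalˡ; ∧-conicalʳ; T-≡; ⇔→≡) renaming (_≟_ to _≟ᵇ_)
open import Data.List using (List; []; _∷_; _++_)
open import Data.List.Properties using (map-cong-local)
open import Data.List.Membership.Propositional using (_∈_; _∉_)
open import Data.List.Membership.Propositional.Properties using (∈-++⁻)
import Data.List.Membership.DecPropositional as DecMembership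
open import Data.List.Relation.Unary.All using (All; []; _∷_)
import Data.List.Relation.Unary.All as All
open import Data.List.Relation.Unary.All.Properties using (++⁻ˡ; ++⁻ʳ; all⁻)
open import Data.List.Relation.Unary.Any using (here; there)
open import Data.Product using (_×_; _,_; ∃; proj₁)
open import Data.Sum using (inj₁; inj₂)
open import Function using (_∘_)
open import Function.Bundles using (_⇔_; mk⇔; Equivalence)
open import Relation.Binary.Definitions using (DecidableEquality)
open import Relation.Binary.PropositionalEquality
open import Relation.Nullary using (¬_; Dec; yes; no; contradiction)
open import Relation.Nullary.Decidable using (decidable-stable)

shannon-intro : (f : Bool → Bool) (v : Bool) → f v ≡ true → f true ∨ f false ≡ true
shannon-intro f true  fv = cong (_∨ f false) fv
shannon-intro f false fv = trans (cong (f true ∨_) fv) (∨-zeroʳ (f true))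

shannon-elim : (f : Bool → Bool) → f true ∨ f false ≡ true → ∃ λ v → f v ≡ true
shannon-elim f t with f true in ft
... | true  = true , ft
... | false = false , t

module _ {Atom : Set} where

  evalF-cong : (φ : Formula Atom) {ν μ : Val Atom} →
    All (λ a → ν a ≡ μ a) (atoms φ) → evalF ν φ ≡ evalF μ φ
  evalF-cong (atom a) (e ∷ []) = e
  evalF-cong ⊤f es = refl
  evalF-cong ⊥f es = refl
  evalF-cong (¬f φ) es = cong not (evalF-cong φ es)
  evalF-cong (φ ∧f χ) es =
    cong₂ _∧_ (evalF-cong φ (++⁻ˡ (atoms φ) es)) (evalF-cong χ (++⁻ʳ (atoms φ) es))
  evalF-cong (φ ∨f χ) es =
    cong₂ _∨_ (evalF-cong φ (++⁻ˡ (atoms φ) es)) (evalF-cong χ (++⁻ʳ (atoms φ) es))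
  evalF-cong (φ ⇒f χ) es =
    cong₂ (λ x y → not x ∨ y) (evalF-cong φ (++⁻ˡ (atoms φ) es)) (evalF-cong χ (++⁻ʳ (atoms φ) es))
  evalF-cong (φ ⇔f χ) es =
    cong₂ (_⇔b_ {Atom}) (evalF-cong φ (++⁻ˡ (atoms φ) es)) (evalF-cong χ (++⁻ʳ (atoms φ) es))

  evalF-agree : {α : List Atom} (φ : Formula Atom) {ν μ : Val Atom} →
    FormulaOn α φ → AgreeOn α ν μ → evalF ν φ ≡ evalF μ φ
  evalF-agree φ on ag = evalF-cong φ (All.map (ag _) on)

  evalLit-cong : {ν μ : Val Atom} (l : Literal Atom) →
    ν (proj₁ l) ≡ μ (proj₁ l) → evalLit ν l ≡ evalLit μ l
  evalLit-cong (_ , b) = cong (λ x → if b then x else not x)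

  evalClause-cong : {ν μ : Val Atom} (C : Clause Atom) →
    All (λ l → ν (proj₁ l) ≡ μ (proj₁ l)) C → evalClause ν C ≡ evalClause μ C
  evalClause-cong {ν} {μ} C es =
    cong or (map-cong-local (All.map (λ {l} → evalLit-cong {ν} {μ} l) es))

  allClauses-cong : (Cs : List (Clause Atom)) {ν μ : Val Atom} →
    (∀ a → ν a ≡ μ a) → allClauses Cs ν ≡ allClauses Cs μ
  allClauses-cong []       pw = refl
  allClauses-cong (C ∷ Cs) pw =
    cong₂ _∧_ (evalClause-cong C (All.tabulate λ _ → pw _)) (allClauses-cong Cs pw)

  allClauses-TLemmas : (T : Theory Atom) (γ : List Atom) {Cs : List (Clause Atom)} →
    All (TLemma T) Cs → All (ClauseOn γ) Cs →
    ∀ {ν} M → AgreeOn γ ν (⟦ T ⟧ M) → allClauses Cs ν ≡ true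
  allClauses-TLemmas T γ lemmas on {ν} M ag =
    Equivalence.to T-≡ (all⁻ (evalClause ν) (All.zipWith holds (lemmas , on)))
    where
    holds : ∀ {C} → TLemma T C × ClauseOn γ C → Bool.T (evalClause ν C)
    holds {C} (valid , onC) =
      Equivalence.from T-≡ (trans (evalClause-cong C (All.map (ag _) onC)) (valid M))

  AgreeOutside : List Atom → Val Atom → Val Atom → Set
  AgreeOutside bs ν μ = ∀ a → a ∉ bs → ν a ≡ μ a

module _ {Atom : Set} (_≟_ : DecidableEquality Atom) where

  update-≡ : (μ : Val Atom) (b : Atom) (v : Bool) → update _≟_ μ b v b ≡ v
  update-≡ μ b v with b ≟ b
  ... | yes _  = refl
  ... | no b≢b = contradiction refl b≢b

  update-≢ : (μ : Val Atom) {a b : Atom} (v : Bool) → a ≢ b → update _≟_ μ b v a ≡ μ a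
  update-≢ μ {a} {b} v a≢b with a ≟ b
  ... | yes a≡b = contradiction a≡b a≢b
  ... | no _    = refl

  agreeOutside-update : {b : Atom} {bs : List Atom} {ν μ : Val Atom} →
    AgreeOutside (b ∷ bs) ν μ → AgreeOutside bs ν (update _≟_ μ b (ν b))
  agreeOutside-update {b} {bs} {ν} {μ} ag a a∉bs = by-cases (a ≟ b)
    where
    by-cases : Dec (a ≡ b) → ν a ≡ update _≟_ μ b (ν b) a
    by-cases (yes refl) = sym (update-≡ μ a (ν a))
    by-cases (no a≢b)   = trans (ag a λ { (here a≡b) → a≢b a≡b ; (there a∈bs) → a∉bs a∈bs })
                                (sym (update-≢ μ (ν b) a≢b))

  agreeOutside-cons : {b : Atom} {bs : List Atom} {ν μ : Val Atom} (v : Bool) →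
    AgreeOutside bs ν (update _≟_ μ b v) → AgreeOutside (b ∷ bs) ν μ
  agreeOutside-cons {μ = μ} v ag a a∉ = trans (ag a (a∉ ∘ there)) (update-≢ μ v (a∉ ∘ here))

  Extensional : (Val Atom → Bool) → Set
  Extensional F = ∀ {ν μ} → (∀ a → ν a ≡ μ a) → F ν ≡ F μ

  existsB-intro : {F : Val Atom → Bool} → Extensional F →
    (bs : List Atom) {μ ν : Val Atom} →
    AgreeOutside bs ν μ → F ν ≡ true → existsB _≟_ bs F μ ≡ true
  existsB-intro F-ext [] ag Fν = trans (F-ext λ a → sym (ag a λ ())) Fν
  existsB-intro F-ext (b ∷ bs) {μ} {ν} ag Fν =
    shannon-intro (λ v → existsB _≟_ bs _ (update _≟_ μ b v)) (ν b)
      (existsB-intro F-ext bs (agreeOutside-update ag) Fν)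

  existsB-elim : (F : Val Atom → Bool) (bs : List Atom) {μ : Val Atom} →
    existsB _≟_ bs F μ ≡ true → ∃ λ ν → AgreeOutside bs ν μ × F ν ≡ true
  existsB-elim F [] {μ} t = μ , (λ _ _ → refl) , t
  existsB-elim F (b ∷ bs) {μ} t
    with v , t′ ← shannon-elim (λ v → existsB _≟_ bs F (update _≟_ μ b v)) t
    with ν , ag , Fν ← existsB-elim F bs t′
    = ν , agreeOutside-cons v ag , Fν

  module _ (T : Theory Atom) (α : List Atom) where

    open DecMembership _≟_ using (_∈?_)

    consistent⇒existsB-TLemmas : (β : List Atom) {Cs : List (Clause Atom)} →
      All (TLemma T) Cs → All (ClauseOn (α ++ β)) Cs →
      {μ : Val Atom} → TConsistentOn T α μ → existsB _≟_ β (allClauses Cs) μ ≡ true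
    consistent⇒existsB-TLemmas β {Cs} lemmas on {μ} (M , M≈μ) =
      existsB-intro (allClauses-cong Cs) β outsideβ
        (allClauses-TLemmas T (α ++ β) lemmas on M onαβ)
      where
      ν : Val Atom
      ν a with a ∈? β
      ... | yes _ = ⟦ T ⟧ M a
      ... | no _  = μ a
      outsideβ : AgreeOutside β ν μ
      outsideβ a a∉β with a ∈? β
      ... | yes a∈β = contradiction a∈β a∉β
      ... | no _    = refl
      onαβ : AgreeOn (α ++ β) ν (⟦ T ⟧ M)
      onαβ a a∈αβ with a ∈? β
      ... | yes _   = refl
      ... | no a∉β with ∈-++⁻ α a∈αβ
      ...   | inj₁ a∈α = sym (M≈μ a a∈α)
      ...   | inj₂ a∈β = contradiction a∈β a∉β

    side-consistent : (φ : Formula Atom) (β : List Atom) {Cs : List (Clause Atom)} →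
      All (TLemma T) Cs → All (ClauseOn (α ++ β)) Cs →
      {μ : Val Atom} → TConsistentOn T α μ → side _≟_ φ β Cs μ ≡ evalF μ φ
    side-consistent φ β lemmas on {μ} cons =
      trans (cong (evalF μ φ ∧_) (consistent⇒existsB-TLemmas β lemmas on cons))
            (∧-identityʳ (evalF μ φ))

    side⇒¬¬consistent : (φ : Formula Atom) (β : List Atom) (Cs : List (Clause Atom)) →
      (∀ b → b ∈ β → b ∉ α) → RulesOut α Cs (TTAneg T α φ) →
      {μ : Val Atom} → side _≟_ φ β Cs μ ≡ true → ¬ ¬ TConsistentOn T α μ
    side⇒¬¬consistent φ β Cs disjoint rulesOut {μ} t inconsistent
      with ν , ag , lemmasν ← existsB-elim (allClauses Cs) β (∧-conicalʳ _ _ t)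
      = rulesOut ν ((μ , (inconsistent , ∧-conicalˡ _ _ t) , onα) , lemmasν)
      where
      onα : AgreeOn α μ ν
      onα a a∈α = sym (ag a λ a∈β → disjoint a a∈β a∈α)

    TEquiv-consistent : (φ φ′ : Formula Atom) → FormulaOn α φ → FormulaOn α φ′ →
      TEquiv T φ φ′ → {μ : Val Atom} → TConsistentOn T α μ → evalF μ φ ≡ evalF μ φ′
    TEquiv-consistent φ φ′ on on′ E {μ} (M , M≈μ) = begin
      evalF μ φ           ≡⟨ evalF-agree φ on (λ a a∈α → sym (M≈μ a a∈α)) ⟩
      evalF (⟦ T ⟧ M) φ   ≡⟨ E M ⟩
      evalF (⟦ T ⟧ M) φ′  ≡⟨ evalF-agree φ′ on′ M≈μ ⟩
      evalF μ φ′          ∎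
      where open ≡-Reasoning

    side-transfer : (φ₁ φ₂ : Formula Atom) (β₁ β₂ : List Atom) (Cs₁ Cs₂ : List (Clause Atom)) →
      (∀ b → b ∈ β₁ → b ∉ α) → FormulaOn α φ₁ → FormulaOn α φ₂ →
      All (TLemma T) Cs₂ → All (ClauseOn (α ++ β₂)) Cs₂ → RulesOut α Cs₁ (TTAneg T α φ₁) →
      TEquiv T φ₁ φ₂ → {μ : Val Atom} →
      side _≟_ φ₁ β₁ Cs₁ μ ≡ true → side _≟_ φ₂ β₂ Cs₂ μ ≡ true
    -- Consistency of μ is only known up to double negation; the goal, a Boolean
    -- equation, is stable under it.
    side-transfer φ₁ φ₂ β₁ β₂ Cs₁ Cs₂ disjoint on₁ on₂ lemmas₂ clausesOn₂ rulesOut₁ E {μ} t =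
      decidable-stable (side _≟_ φ₂ β₂ Cs₂ μ ≟ᵇ true)
        (λ ¬goal → side⇒¬¬consistent φ₁ β₁ Cs₁ disjoint rulesOut₁ t (¬goal ∘ goal))
      where
      open ≡-Reasoning
      goal : TConsistentOn T α μ → side _≟_ φ₂ β₂ Cs₂ μ ≡ true
      goal cons = begin
        side _≟_ φ₂ β₂ Cs₂ μ  ≡⟨ side-consistent φ₂ β₂ lemmas₂ clausesOn₂ cons ⟩
        evalF μ φ₂            ≡⟨ TEquiv-consistent φ₁ φ₂ on₁ on₂ E cons ⟨
        evalF μ φ₁            ≡⟨ ∧-conicalˡ _ _ t ⟩
        true                  ∎

theorem6 : {Atom : Set} (_≟_ : DecidableEquality Atom) (T : Theory Atom)
    (α β β' : List Atom) (φ φ' : Formula Atom)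
    (Cs Cs' : List (Clause Atom)) →
    (∀ b → b ∈ β → b ∉ α) → (∀ b → b ∈ β' → b ∉ α) →
    FormulaOn α φ → FormulaOn α φ' →
    All (TLemma T) Cs → All (ClauseOn (α ++ β)) Cs →
    All (TLemma T) Cs' → All (ClauseOn (α ++ β')) Cs' →
    RulesOut α Cs (TTAneg T α φ) → RulesOut α Cs' (TTAneg T α φ') →
    TEquiv T φ φ' ⇔ PropEquiv (side _≟_ φ β Cs) (side _≟_ φ' β' Cs')
theorem6 _≟_ T α β β' φ φ' Cs Cs' d d' on on' l o l' o' r r' = mk⇔ to from
  where
  to : TEquiv T φ φ' → PropEquiv (side _≟_ φ β Cs) (side _≟_ φ' β' Cs')
  to E μ = ⇔→≡ {z = true} (mk⇔ (side-transfer _≟_ T α φ φ' β β' Cs Cs' d on on' l' o' r E)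
                                (side-transfer _≟_ T α φ' φ β' β Cs' Cs d' on' on l o r' (sym ∘ E)))
  from : PropEquiv (side _≟_ φ β Cs) (side _≟_ φ' β' Cs') → TEquiv T φ φ'
  from P M = begin
    evalF (⟦ T ⟧ M) φ              ≡⟨ side-consistent _≟_ T α φ β l o realised ⟨
    side _≟_ φ β Cs (⟦ T ⟧ M)      ≡⟨ P (⟦ T ⟧ M) ⟩
    side _≟_ φ' β' Cs' (⟦ T ⟧ M)   ≡⟨ side-consistent _≟_ T α φ' β' l' o' realised ⟩
    evalF (⟦ T ⟧ M) φ'             ∎
    where
    open ≡-Reasoning
    realised : TConsistentOn T α (⟦ T ⟧ M)
    realised = M , λ _ _ → refl
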